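{- Let $q\ge 1$ be an integer and let $\mathcal{Q}$ be a generalized quadrangle of order $(q,q)$. The line graph of the incidence graph of $\mathcal{Q}$ admits a perfect $1$-code if and only if $q=2$.
   Context: A generalized quadrangle of order $(s,t)$ is a point-line incidence structure in which every line has $s+1$ points, every point lies on $t+1$ lines, two points lie on at most one common line, and for every point $p$ and line $\ell$ not through $p$ there is exactly one point on $\ell$ collinear with $p$. Its incidence graph is the bipartite graph on points and lines with $p\sim \ell$ iff $p\in\ell$. The line graph of a graph has the edges as vertices, adjacent when they share an endpoint. A perfect $1$-code is a vertex subset $C$ such that the closed neighbourhoods of the vertices of $C$ partition the vertex set. -}

module Defs where

open import Data.Nat using (ℕ; _+_; _≤_)
open import Data.Fin using (Fin)
open import Data.Bool using (Bool; true; false; T; if_then_else_)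
open import Data.List using (List; map; allFin)
open import Data.Nat.ListAction using (sum)
open import Data.Product using (Σ; Σ-syntax; _×_; _,_; ∃; ∃-syntax)
open import Data.Sum using (_⊎_)
open import Relation.Nullary using (¬_)
open import Relation.Binary.PropositionalEquality using (_≡_; _≢_)

count : {m : ℕ} → (Fin m → Bool) → ℕ
count {m} f = sum (map (λ i → if f i then 1 else 0) (allFin m))

-- A finite incidence structure: points Fin m, lines Fin n,
-- incidence  I p ℓ ≡ true  meaning  p ∈ ℓ.
Incidence : ℕ → ℕ → Set
Incidence m n = Fin m → Fin n → Bool

Collinear : {m n : ℕ} → Incidence m n → Fin m → Fin m → Set
Collinear {m} {n} I p x = Σ[ ℓ ∈ Fin n ] (T (I p ℓ) × T (I x ℓ))

record IsGQ (s t : ℕ) {m n : ℕ} (I : Incidence m n) : Set where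
  field
    nonempty      : Fin m
    linePoints    : (ℓ : Fin n) → count (λ p → I p ℓ) ≡ s + 1
    pointLines    : (p : Fin m) → count (λ ℓ → I p ℓ) ≡ t + 1
    atMostOneLine : (p x : Fin m) (ℓ ℓ' : Fin n) → p ≢ x →
                    T (I p ℓ) → T (I x ℓ) → T (I p ℓ') → T (I x ℓ') → ℓ ≡ ℓ'
    gqAxiom       : (p : Fin m) (ℓ : Fin n) → ¬ T (I p ℓ) →
                    Σ[ x ∈ Fin m ] ((T (I x ℓ) × Collinear I p x) ×
                      ((y : Fin m) → T (I y ℓ) → Collinear I p y → y ≡ x))

-- Vertices of the line graph of the incidence graph: the edges of the
-- incidence graph, i.e. the flags (p , ℓ) with p ∈ ℓ.
Flag : {m n : ℕ} → Incidence m n → Set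
Flag {m} {n} I = Σ[ p ∈ Fin m ] Σ[ ℓ ∈ Fin n ] T (I p ℓ)

flagPoint : {m n : ℕ} {I : Incidence m n} → Flag I → Fin m
flagPoint (p , _ , _) = p

flagLine : {m n : ℕ} {I : Incidence m n} → Flag I → Fin n
flagLine (_ , ℓ , _) = ℓ

LAdj : {m n : ℕ} (I : Incidence m n) → Flag I → Flag I → Set
LAdj I f g = f ≢ g × (flagPoint f ≡ flagPoint g ⊎ flagLine f ≡ flagLine g)

InClosedNbhd : {m n : ℕ} (I : Incidence m n) → Flag I → Flag I → Set
InClosedNbhd I c v = c ≡ v ⊎ LAdj I c v

IsPerfectCode : {m n : ℕ} (I : Incidence m n) → (Flag I → Bool) → Set
IsPerfectCode I C = (v : Flag I) →
  Σ[ c ∈ Flag I ] ((T (C c) × InClosedNbhd I c v) ×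
    ((c' : Flag I) → T (C c') → InClosedNbhd I c' v → c' ≡ c))

HasPerfectCode : {m n : ℕ} (I : Incidence m n) → Set
HasPerfectCode I = Σ[ C ∈ (Flag I → Bool) ] IsPerfectCode I C

-- A generalized quadrangle of order (s, t) has (s + 1)(st + 1) points (project the points off a
-- line ℓ₀ onto ℓ₀), hence (s + 1)(st + 1)(t + 1) flags, and a flag is adjacent or equal to exactly
-- s + t + 1 flags.  A perfect code therefore needs 2q + 1 ∣ (q + 1)²(q² + 1) when s = t = q, and
-- 16 (q + 1)²(q² + 1) ≡ 5 (mod 2q + 1) leaves only q = 2.
--
-- For q = 2 take non-collinear points a, b: the points X₀, X₁, X₂ of {a, b}^⊥ are pairwise
-- non-collinear, and a point d collinear with X₀ and X₁ but with neither a nor b is collinear with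
-- X₂ as well.  The nine lines joining {a, b, d} to {X₀, X₁, X₂} each carry exactly one further
-- point, every other point lies on exactly one of them, and these nine (point, line) flags form a
-- perfect code.

module Submission where

open import Defs
import Algebra.Properties.Semiring.Sum as SemiringSum
open import Data.Bool using (Bool; true; false; T; not; _∧_; _∨_; if_then_else_)
open import Data.Bool.Properties using (T?; T-∧; T-∨; T-≡; T-irrelevant; ∧-zeroʳ)
open import Data.Empty using (⊥; ⊥-elim)
open import Data.Fin using (Fin; zero; suc)
open import Data.Fin.Patterns using (0F; 1F; 2F)
open import Data.Fin.Properties using (_≟_; suc-injective; any?)
open import Data.List.Properties using (map-tabulate)
import Data.Nat.ListAction as List
open import Data.Nat using (ℕ; zero; suc; pred; _+_; _*_; _≤_; z≤n; s≤s)
open import Data.Nat.Properties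
  using (+-*-semiring; +-comm; +-identityʳ; *-identityʳ; *-identityˡ; *-assoc; ≤-trans; m≤n+m; <⇒≱)
open import Data.Nat.Divisibility using (_∣_; divides; _∣?_; ∣m+n∣m⇒∣n; m∣m*n; ∣⇒≤)
open import Data.Nat.Tactic.RingSolver using (solve-∀)
open import Data.Product using (Σ-syntax; ∃-syntax; _×_; _,_; proj₁; proj₂; curry)
open import Data.Sum as Sum using (_⊎_; inj₁; inj₂)
open import Function.Bundles using (_⇔_; mk⇔; Equivalence)
open import Function using (_∘_; id; flip)
open import Relation.Nullary using (¬_; Dec; yes; no; contradiction)
open import Relation.Nullary.Decidable
  using (⌊_⌋; map′; from-no; ¬?; _×-dec_; _⊎-dec_; toWitness; fromWitness)
open import Relation.Binary.PropositionalEquality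

open SemiringSum +-*-semiring
  using (sum-syntax; sum-cong-≗; ∑-comm; ∑-distrib-+; *-distribʳ-sum)

private
  variable
    a b k n : ℕ

𝟙 : Bool → ℕ
𝟙 b = if b then 1 else 0

𝟙-true : {b : Bool} → T b → 𝟙 b ≡ 1
𝟙-true {true} _ = refl

𝟙-false : {b : Bool} → ¬ T b → 𝟙 b ≡ 0
𝟙-false {false} _ = refl
𝟙-false {true} ¬t = ⊥-elim (¬t _)

𝟙-split : (a b : Bool) → 𝟙 b ≡ 𝟙 (a ∧ b) + 𝟙 (not a ∧ b)
𝟙-split true  b = sym (+-identityʳ (𝟙 b))
𝟙-split false b = refl

𝟙-∧-∨ : ∀ x a b → 𝟙 (x ∧ (a ∨ b)) ≡ 𝟙 (a ∧ x) + 𝟙 (b ∧ (not a ∧ x))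
𝟙-∧-∨ false a     b     = sym (cong₂ _+_ (cong 𝟙 (∧-zeroʳ a))
                                         (cong 𝟙 (trans (cong (b ∧_) (∧-zeroʳ (not a))) (∧-zeroʳ b))))
𝟙-∧-∨ true  true  b     = cong (1 +_) (cong 𝟙 (sym (∧-zeroʳ b)))
𝟙-∧-∨ true  false true  = refl
𝟙-∧-∨ true  false false = refl

T-∧⁺ : {x y : Bool} → T x → T y → T (x ∧ y)
T-∧⁺ = curry (Equivalence.from T-∧)

T-∧⁻ : {x y : Bool} → T (x ∧ y) → T x × T y
T-∧⁻ = Equivalence.to T-∧

T-not⁺ : {x : Bool} → ¬ T x → T (not x)
T-not⁺ {false} _ = _
T-not⁺ {true} ¬t = ¬t _

T-not⁻ : {x : Bool} → T (not x) → ¬ T x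
T-not⁻ {false} _ ()

T⇒≡true : {x : Bool} → T x → x ≡ true
T⇒≡true = Equivalence.to T-≡

∑-zero : {f : Fin k → ℕ} → (∀ i → f i ≡ 0) → ∑[ i < k ] f i ≡ 0
∑-zero {zero} _ = refl
∑-zero {suc k} f≗0 = cong₂ _+_ (f≗0 zero) (∑-zero (f≗0 ∘ suc))

∑-const : (k c : ℕ) → ∑[ i < k ] c ≡ k * c
∑-const zero c = refl
∑-const (suc k) c = cong (c +_) (∑-const k c)

∑-single : (f : Fin k → ℕ) (j : Fin k) → (∀ i → i ≢ j → f i ≡ 0) → ∑[ i < k ] f i ≡ f j
∑-single f zero vanish =
  trans (cong (f zero +_) (∑-zero {f = f ∘ suc} (λ i → vanish (suc i) λ ()))) (+-identityʳ (f zero))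
∑-single f (suc j) vanish =
  trans (cong (_+ ∑[ i < _ ] f (suc i)) (vanish zero λ ()))
        (∑-single (f ∘ suc) j (λ i i≢j → vanish (suc i) (i≢j ∘ suc-injective)))

count-suc : (P : Fin (suc k) → Bool) → count P ≡ 𝟙 (P zero) + count (P ∘ suc)
count-suc P = cong (λ xs → 𝟙 (P zero) + List.sum xs)
  (trans (map-tabulate suc (𝟙 ∘ P)) (sym (map-tabulate id (𝟙 ∘ P ∘ suc))))

count≡∑ : (P : Fin k → Bool) → count P ≡ ∑[ i < k ] 𝟙 (P i)
count≡∑ {zero} P = refl
count≡∑ {suc k} P = trans (count-suc P) (cong (𝟙 (P zero) +_) (count≡∑ (P ∘ suc)))

count-cong : {P Q : Fin k → Bool} → (∀ i → P i ≡ Q i) → count P ≡ count Q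
count-cong {P = P} {Q} P≗Q = trans (count≡∑ P) (trans (sum-cong-≗ (cong 𝟙 ∘ P≗Q)) (sym (count≡∑ Q)))

count-unique : (P : Fin k → Bool) (j : Fin k) → T (P j) → (∀ i → T (P i) → i ≡ j) → count P ≡ 1
count-unique P j Pj unique = begin
  count P               ≡⟨ count≡∑ P ⟩
  ∑[ i < _ ] 𝟙 (P i)    ≡⟨ ∑-single (𝟙 ∘ P) j (λ i i≢j → 𝟙-false (i≢j ∘ unique i)) ⟩
  𝟙 (P j)               ≡⟨ 𝟙-true Pj ⟩
  1                     ∎
  where open ≡-Reasoning

count-none : (P : Fin k → Bool) → (∀ i → ¬ T (P i)) → count P ≡ 0
count-none P none = trans (count≡∑ P) (∑-zero (λ i → 𝟙-false (none i)))

count-witness : (P : Fin k → Bool) → count P ≡ suc n → ∃[ i ] T (P i)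
count-witness {zero} P ()
count-witness {suc k} P eq with P zero in P₀ | trans (sym (count-suc P)) eq
... | true  | _   = zero , subst T (sym P₀) _
... | false | eq′ = let i , Pi = count-witness (P ∘ suc) eq′ in suc i , Pi

count-split : (Q P : Fin k → Bool) →
  count P ≡ count (λ i → Q i ∧ P i) + count (λ i → not (Q i) ∧ P i)
count-split Q P = begin
  count P                                              ≡⟨ count≡∑ P ⟩
  ∑[ i < _ ] 𝟙 (P i)                                   ≡⟨ sum-cong-≗ (λ i → 𝟙-split (Q i) (P i)) ⟩
  ∑[ i < _ ] (𝟙 (Q i ∧ P i) + 𝟙 (not (Q i) ∧ P i))
    ≡⟨ ∑-distrib-+ (λ i → 𝟙 (Q i ∧ P i)) (λ i → 𝟙 (not (Q i) ∧ P i)) ⟩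
  ∑[ i < _ ] 𝟙 (Q i ∧ P i) + ∑[ i < _ ] 𝟙 (not (Q i) ∧ P i)
    ≡⟨ cong₂ _+_ (count≡∑ (λ i → Q i ∧ P i)) (count≡∑ (λ i → not (Q i) ∧ P i)) ⟨
  count (λ i → Q i ∧ P i) + count (λ i → not (Q i) ∧ P i) ∎
  where open ≡-Reasoning

infixl 6 _∖_

_∖_ : (Fin k → Bool) → Fin k → Fin k → Bool
(P ∖ j) i = not ⌊ i ≟ j ⌋ ∧ P i

T-∖⁺ : (P : Fin k → Bool) {i j : Fin k} → i ≢ j → T (P i) → T ((P ∖ j) i)
T-∖⁺ P {i} {j} i≢j Pi with i ≟ j
... | yes i≡j = i≢j i≡j
... | no _    = Pi

T-∖⁻ : (P : Fin k → Bool) {i j : Fin k} → T ((P ∖ j) i) → i ≢ j × T (P i)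
T-∖⁻ P {i} {j} P∖ji with i ≟ j
... | no i≢j = i≢j , P∖ji

T-≟⁺ : {i j : Fin k} → i ≡ j → T ⌊ i ≟ j ⌋
T-≟⁺ {i = i} {j} i≡j with i ≟ j
... | yes _   = _
... | no i≢j  = i≢j i≡j

T-≟⁻ : {i j : Fin k} → T ⌊ i ≟ j ⌋ → i ≡ j
T-≟⁻ {i = i} {j} h with i ≟ j
... | yes i≡j = i≡j

count-at : (P : Fin k → Bool) (j : Fin k) → count (λ i → ⌊ i ≟ j ⌋ ∧ P i) ≡ 𝟙 (P j)
count-at P j with T? (P j)
... | yes Pj = trans
  (count-unique (λ i → ⌊ i ≟ j ⌋ ∧ P i) j (T-∧⁺ (T-≟⁺ refl) Pj) λ i h → T-≟⁻ (proj₁ (T-∧⁻ h)))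
  (sym (𝟙-true Pj))
... | no ¬Pj = trans
  (count-none (λ i → ⌊ i ≟ j ⌋ ∧ P i) λ i h →
    let i≡j , Pi = T-∧⁻ h in ¬Pj (subst (T ∘ P) (T-≟⁻ i≡j) Pi))
  (sym (𝟙-false ¬Pj))

count-∖ : (P : Fin k → Bool) {j : Fin k} → T (P j) → count P ≡ suc (count (P ∖ j))
count-∖ P {j} Pj = trans (count-split (λ i → ⌊ i ≟ j ⌋) P)
  (cong (_+ count (P ∖ j)) (trans (count-at P j) (𝟙-true Pj)))

count-∖-pred : (P : Fin k → Bool) → count P ≡ suc n → {j : Fin k} → T (P j) → count (P ∖ j) ≡ n
count-∖-pred P eq Pj = cong pred (trans (sym (count-∖ P Pj)) eq)

count-zero : (P : Fin k → Bool) → count P ≡ 0 → ∀ i → ¬ T (P i)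
count-zero P eq i Pi with () ← trans (sym eq) (count-∖ P Pi)

another : (P : Fin k → Bool) → count P ≡ suc (suc n) → {i : Fin k} → T (P i) →
  ∃[ j ] T (P j) × j ≢ i
another P eq {i} Pi with j , P∖ij ← count-witness (P ∖ i) (count-∖-pred P eq Pi) =
  let j≢i , Pj = T-∖⁻ P {j} {i} P∖ij in j , Pj , j≢i

third : (P : Fin k → Bool) → count P ≡ 3 → {i j : Fin k} → T (P i) → T (P j) → j ≢ i →
  ∃[ l ] T (P l) × l ≢ i × l ≢ j
third P eq {i} {j} Pi Pj j≢i
  with l , P∖il , l≢j ← another (P ∖ i) (count-∖-pred P eq Pi) (T-∖⁺ P j≢i Pj) =
  let l≢i , Pl = T-∖⁻ P {l} {i} P∖il in l , Pl , l≢i , l≢j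

exhaust₃ : (P : Fin k → Bool) → count P ≡ 3 → {i j l : Fin k} → T (P i) → T (P j) → T (P l) →
  j ≢ i → l ≢ i → l ≢ j → ∀ x → T (P x) → x ≡ i ⊎ x ≡ j ⊎ x ≡ l
exhaust₃ P eq {i} {j} {l} Pi Pj Pl j≢i l≢i l≢j x Px with x ≟ i | x ≟ j | x ≟ l
... | yes x≡i | _       | _       = inj₁ x≡i
... | no _    | yes x≡j | _       = inj₂ (inj₁ x≡j)
... | no _    | no _    | yes x≡l = inj₂ (inj₂ x≡l)
... | no x≢i  | no x≢j  | no x≢l  =
  ⊥-elim (count-zero (P ∖ i ∖ j ∖ l) none x
            (T-∖⁺ (P ∖ i ∖ j) x≢l (T-∖⁺ (P ∖ i) x≢j (T-∖⁺ P x≢i Px))))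
  where
  none : count (P ∖ i ∖ j ∖ l) ≡ 0
  none = count-∖-pred (P ∖ i ∖ j) (count-∖-pred (P ∖ i) (count-∖-pred P eq Pi) (T-∖⁺ P j≢i Pj))
           (T-∖⁺ (P ∖ i) l≢j (T-∖⁺ P l≢i Pl))

triple : {A : Set} → A → A → A → Fin 3 → A
triple x y z 0F = x
triple x y z 1F = y
triple x y z 2F = z

triple-pairwise : {A : Set} (R : A → A → Set) → (∀ {u v} → R u v → R v u) →
  ∀ {x y z} → R x y → R x z → R y z → ∀ i j → i ≢ j → R (triple x y z i) (triple x y z j)
triple-pairwise R sym′ Rxy Rxz Ryz 0F 0F 0≢0 = ⊥-elim (0≢0 refl)
triple-pairwise R sym′ Rxy Rxz Ryz 0F 1F _   = Rxy
triple-pairwise R sym′ Rxy Rxz Ryz 0F 2F _   = Rxz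
triple-pairwise R sym′ Rxy Rxz Ryz 1F 0F _   = sym′ Rxy
triple-pairwise R sym′ Rxy Rxz Ryz 1F 1F 1≢1 = ⊥-elim (1≢1 refl)
triple-pairwise R sym′ Rxy Rxz Ryz 1F 2F _   = Ryz
triple-pairwise R sym′ Rxy Rxz Ryz 2F 0F _   = sym′ Rxz
triple-pairwise R sym′ Rxy Rxz Ryz 2F 1F _   = sym′ Ryz
triple-pairwise R sym′ Rxy Rxz Ryz 2F 2F 2≢2 = ⊥-elim (2≢2 refl)

another-index : (j : Fin 3) → ∃[ k ] k ≢ j
another-index 0F = 1F , λ ()
another-index 1F = 0F , λ ()
another-index 2F = 0F , λ ()

three-distinct : (P : Fin k → Bool) → count P ≡ 3 →
  ∃[ f ] (∀ i → T (P (f i))) × (∀ i j → i ≢ j → f i ≢ f j)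
three-distinct P eq
  with x , Px ← count-witness P eq
  with y , Py , y≢x ← another P eq Px
  with z , Pz , z≢x , z≢y ← third P eq Px Py y≢x =
  triple x y z , P-triple , triple-pairwise _≢_ ≢-sym (≢-sym y≢x) (≢-sym z≢x) (≢-sym z≢y)
  where
  P-triple : ∀ i → T (P (triple x y z i))
  P-triple 0F = Px
  P-triple 1F = Py
  P-triple 2F = Pz

∑-count-unique : (R : Fin a → Fin b → Bool) (i₀ : Fin a) (j₀ : Fin b) → T (R i₀ j₀) →
  (∀ i j → T (R i j) → i ≡ i₀ × j ≡ j₀) → ∑[ i < a ] count (R i) ≡ 1
∑-count-unique R i₀ j₀ R₀ unique = trans
  (∑-single (count ∘ R) i₀ λ i i≢i₀ → count-none (R i) λ j Rij → i≢i₀ (proj₁ (unique i j Rij)))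
  (count-unique (R i₀) j₀ R₀ λ j Rj → proj₂ (unique i₀ j Rj))

∑-count-none : (R : Fin a → Fin b → Bool) → (∀ i j → ¬ T (R i j)) → ∑[ i < a ] count (R i) ≡ 0
∑-count-none R none = ∑-zero λ i → count-none (R i) (none i)

∑-rotate : {c : ℕ} (f : Fin a → Fin b → Fin c → ℕ) →
  ∑[ x < a ] ∑[ y < b ] ∑[ z < c ] f x y z ≡ ∑[ y < b ] ∑[ z < c ] ∑[ x < a ] f x y z
∑-rotate f = trans (∑-comm λ x y → ∑[ z < _ ] f x y z) (sum-cong-≗ λ y → ∑-comm λ x z → f x y z)

count-complement : (P : Fin k → Bool) → count P + count (not ∘ P) ≡ k
count-complement {k} P = begin
  count P + count (not ∘ P)                   ≡⟨ cong₂ _+_ (count≡∑ P) (count≡∑ (not ∘ P)) ⟩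
  ∑[ i < k ] 𝟙 (P i) + ∑[ i < k ] 𝟙 (not (P i)) ≡⟨ ∑-distrib-+ (𝟙 ∘ P) (𝟙 ∘ not ∘ P) ⟨
  ∑[ i < k ] (𝟙 (P i) + 𝟙 (not (P i)))        ≡⟨ sum-cong-≗ (λ i → 𝟙-complement (P i)) ⟩
  ∑[ i < k ] 1                                ≡⟨ ∑-const k 1 ⟩
  k * 1                                       ≡⟨ *-identityʳ k ⟩
  k                                           ∎
  where
  open ≡-Reasoning
  𝟙-complement : ∀ x → 𝟙 x + 𝟙 (not x) ≡ 1
  𝟙-complement true  = refl
  𝟙-complement false = refl

∑∑-swap : {c d : ℕ} (f : Fin a → Fin b → Fin c → Fin d → ℕ) →
  ∑[ w < a ] ∑[ x < b ] ∑[ y < c ] ∑[ z < d ] f w x y z ≡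
  ∑[ y < c ] ∑[ z < d ] ∑[ w < a ] ∑[ x < b ] f w x y z
∑∑-swap f = trans (sum-cong-≗ λ w → ∑-rotate (f w))
                  (∑-rotate λ w y z → ∑[ x < _ ] f w x y z)

module Flags {m n : ℕ} (I : Incidence m n) where

  flag-≡ : {p p′ : Fin m} {ℓ ℓ′ : Fin n} {pℓ : T (I p ℓ)} {pℓ′ : T (I p′ ℓ′)} →
    p ≡ p′ → ℓ ≡ ℓ′ → _≡_ {A = Flag I} (p , ℓ , pℓ) (p′ , ℓ′ , pℓ′)
  flag-≡ refl refl = cong (λ pℓ → _ , _ , pℓ) (T-irrelevant _ _)

  Shares : Flag I → Flag I → Set
  Shares c v = flagPoint {I = I} c ≡ flagPoint {I = I} v ⊎ flagLine {I = I} c ≡ flagLine {I = I} v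

  InClosedNbhd⇒Shares : {c v : Flag I} → InClosedNbhd I c v → Shares c v
  InClosedNbhd⇒Shares (inj₁ refl)         = inj₁ refl
  InClosedNbhd⇒Shares (inj₂ (_ , shared)) = shared

  Shares⇒InClosedNbhd : (c v : Flag I) → Shares c v → InClosedNbhd I c v
  Shares⇒InClosedNbhd (p , ℓ , _) (p′ , ℓ′ , _) shared with p ≟ p′ | ℓ ≟ ℓ′
  ... | yes p≡p′ | yes ℓ≡ℓ′ = inj₁ (flag-≡ p≡p′ ℓ≡ℓ′)
  ... | no p≢p′  | _        = inj₂ (p≢p′ ∘ cong (flagPoint {I = I}) , shared)
  ... | yes _    | no ℓ≢ℓ′  = inj₂ (ℓ≢ℓ′ ∘ cong (flagLine {I = I}) , shared)

  shares? : Fin m → Fin n → Fin m → Fin n → Bool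
  shares? p ℓ p′ ℓ′ = ⌊ p ≟ p′ ⌋ ∨ ⌊ ℓ ≟ ℓ′ ⌋

  T-shares?⁺ : {p p′ : Fin m} {ℓ ℓ′ : Fin n} → p ≡ p′ ⊎ ℓ ≡ ℓ′ → T (shares? p ℓ p′ ℓ′)
  T-shares?⁺ (inj₁ p≡p′) = Equivalence.from T-∨ (inj₁ (T-≟⁺ p≡p′))
  T-shares?⁺ (inj₂ ℓ≡ℓ′) = Equivalence.from T-∨ (inj₂ (T-≟⁺ ℓ≡ℓ′))

  T-shares?⁻ : {p p′ : Fin m} {ℓ ℓ′ : Fin n} → T (shares? p ℓ p′ ℓ′) → p ≡ p′ ⊎ ℓ ≡ ℓ′
  T-shares?⁻ h = Sum.map T-≟⁻ T-≟⁻ (Equivalence.to T-∨ h)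

  codeword : (Flag I → Bool) → Fin m → Fin n → Bool
  codeword C p ℓ with T? (I p ℓ)
  ... | yes pℓ = C (p , ℓ , pℓ)
  ... | no _   = false

  codeword⁺ : (C : Flag I → Bool) {p : Fin m} {ℓ : Fin n} (pℓ : T (I p ℓ)) →
    T (C (p , ℓ , pℓ)) → T (codeword C p ℓ)
  codeword⁺ C {p} {ℓ} pℓ Cpℓ with T? (I p ℓ)
  ... | yes pℓ′ = subst (λ pℓ → T (C (p , ℓ , pℓ))) (T-irrelevant pℓ pℓ′) Cpℓ
  ... | no ¬pℓ  = ¬pℓ pℓ

  codeword⁻ : (C : Flag I → Bool) {p : Fin m} {ℓ : Fin n} →
    T (codeword C p ℓ) → Σ[ pℓ ∈ T (I p ℓ) ] T (C (p , ℓ , pℓ))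
  codeword⁻ C {p} {ℓ} h with T? (I p ℓ)
  ... | yes pℓ = pℓ , h

2q+1∣[q+1]²[q²+1]⇒q≡2 : (q : ℕ) → 1 ≤ q → suc q + q ∣ (q + 1) * (q * q + 1) * suc q → q ≡ 2
2q+1∣[q+1]²[q²+1]⇒q≡2 q 1≤q (divides k flags≡k*u) = small q 1≤q u∣5
  where
  u = suc q + q
  identity : ∀ q → let u = suc q + q in
    u * (u * u * u + 2 * u + 8) + 5 ≡ 16 * ((q + 1) * (q * q + 1) * suc q)
  identity = solve-∀
  u∣5 : u ∣ 5
  u∣5 = ∣m+n∣m⇒∣n
    (divides (16 * k) (trans (identity q) (trans (cong (16 *_) flags≡k*u) (sym (*-assoc 16 k u)))))
    (m∣m*n (u * u * u + 2 * u + 8))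
  small : ∀ q → 1 ≤ q → suc q + q ∣ 5 → q ≡ 2
  small 1 _ 3∣5 = contradiction 3∣5 (from-no (3 ∣? 5))
  small 2 _ _   = refl
  small (suc (suc (suc q))) _ u∣5 = contradiction (∣⇒≤ u∣5)
    (<⇒≱ (s≤s (s≤s (s≤s (s≤s (≤-trans (s≤s (s≤s z≤n)) (m≤n+m (suc (suc (suc q))) q)))))))

module GeneralizedQuadrangle {s t m n : ℕ} {I : Incidence m n} (gq : IsGQ s t I) where
  open IsGQ gq

  lines-through : (p : Fin m) → count (I p) ≡ suc t
  lines-through p = trans (pointLines p) (+-comm t 1)

  points-on : (ℓ : Fin n) → count (λ p → I p ℓ) ≡ suc s
  points-on ℓ = trans (linePoints ℓ) (+-comm s 1)

  infix 4 _~_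

  _~_ : Fin m → Fin m → Set
  _~_ = Collinear I

  ~-sym : ∀ {x y} → x ~ y → y ~ x
  ~-sym (ℓ , xℓ , yℓ) = ℓ , yℓ , xℓ

  _~?_ : ∀ x y → Dec (x ~ y)
  x ~? y = map′ (λ (ℓ , h) → ℓ , T-∧⁻ h) (λ (ℓ , xℓ , yℓ) → ℓ , T-∧⁺ xℓ yℓ)
                    (any? λ ℓ → T? (I x ℓ ∧ I y ℓ))

  no-triangle : ∀ {x y z ℓ} → ¬ T (I x ℓ) → T (I y ℓ) → T (I z ℓ) → y ≢ z → x ~ y → x ~ z → ⊥
  no-triangle {x} {ℓ = ℓ} x∉ℓ yℓ zℓ y≢z x~y x~z with _ , _ , unique ← gqAxiom x ℓ x∉ℓ =
    y≢z (trans (unique _ yℓ x~y) (sym (unique _ zℓ x~z)))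

  project : ∀ x ℓ → ¬ T (I x ℓ) → ∃[ y ] T (I y ℓ) × x ~ y
  project x ℓ x∉ℓ = let y , yℓ~x , _ = gqAxiom x ℓ x∉ℓ in y , yℓ~x

  Triad : (Fin 3 → Fin m) → Set
  Triad X = ∀ i j → i ≢ j → ¬ X i ~ X j

  triad-meets-line-once : ∀ {X} → Triad X → ∀ {ℓ i j} → T (I (X i) ℓ) → T (I (X j) ℓ) → i ≡ j
  triad-meets-line-once triad {ℓ} {i} {j} Xiℓ Xjℓ with i ≟ j
  ... | yes i≡j = i≡j
  ... | no i≢j  = ⊥-elim (triad i j i≢j (ℓ , Xiℓ , Xjℓ))

  module PointsOffLine (ℓ₀ : Fin n) where

    off : Fin m → Bool
    off x = not (I x ℓ₀)

    meets : Fin m → Fin m → Fin n → Bool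
    meets x y ℓ = I y ℓ₀ ∧ I y ℓ ∧ off x ∧ I x ℓ

    meets⁻ : ∀ {x y ℓ} → T (meets x y ℓ) → T (I y ℓ₀) × T (I y ℓ) × ¬ T (I x ℓ₀) × T (I x ℓ)
    meets⁻ {x} {y} {ℓ} h =
      let yℓ₀ , h′ = T-∧⁻ h ; yℓ , h″ = T-∧⁻ {I y ℓ} h′ ; xoff , xℓ = T-∧⁻ {off x} h″
      in yℓ₀ , yℓ , T-not⁻ xoff , xℓ

    projection-unique : ∀ x → ∑[ y < m ] count (meets x y) ≡ 𝟙 (off x)
    projection-unique x with T? (I x ℓ₀)
    ... | yes xℓ₀ =
      trans (∑-count-none (meets x) λ y ℓ h → proj₁ (proj₂ (proj₂ (meets⁻ h))) xℓ₀)
            (sym (𝟙-false λ h → T-not⁻ h xℓ₀))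
    ... | no x∉ℓ₀ with gqAxiom x ℓ₀ x∉ℓ₀
    ... | y , (yℓ₀ , ℓ , xℓ , yℓ) , unique =
      trans (∑-count-unique (meets x) y ℓ (T-∧⁺ yℓ₀ (T-∧⁺ yℓ (T-∧⁺ (T-not⁺ x∉ℓ₀) xℓ))) meets-xyℓ)
            (sym (𝟙-true (T-not⁺ x∉ℓ₀)))
      where
      meets-xyℓ : ∀ y′ ℓ′ → T (meets x y′ ℓ′) → y′ ≡ y × ℓ′ ≡ ℓ
      meets-xyℓ y′ ℓ′ h with y′ℓ₀ , y′ℓ′ , _ , xℓ′ ← meets⁻ h
                       with refl ← unique y′ y′ℓ₀ (ℓ′ , xℓ′ , y′ℓ′) =
        refl , atMostOneLine x y ℓ′ ℓ (λ { refl → x∉ℓ₀ yℓ₀ }) xℓ′ y′ℓ′ xℓ yℓ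

    points-off : ∀ {y ℓ} → T (I y ℓ₀) → T (I y ℓ) → ℓ ≢ ℓ₀ → count (λ x → off x ∧ I x ℓ) ≡ s
    points-off {y} {ℓ} yℓ₀ yℓ ℓ≢ℓ₀ = cong pred (begin
      suc (count (λ x → off x ∧ I x ℓ))
        ≡⟨ cong (_+ count (λ x → off x ∧ I x ℓ)) (count-unique _ y (T-∧⁺ yℓ₀ yℓ) only-y) ⟨
      count (λ x → I x ℓ₀ ∧ I x ℓ) + count (λ x → off x ∧ I x ℓ)
        ≡⟨ count-split (λ x → I x ℓ₀) (λ x → I x ℓ) ⟨
      count (λ x → I x ℓ)
        ≡⟨ points-on ℓ ⟩
      suc s ∎)
      where
      open ≡-Reasoning
      only-y : ∀ x → T (I x ℓ₀ ∧ I x ℓ) → x ≡ y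
      only-y x h with x ≟ y
      ... | yes x≡y = x≡y
      ... | no x≢y  = let xℓ₀ , xℓ = T-∧⁻ h in
                      ⊥-elim (ℓ≢ℓ₀ (atMostOneLine x y ℓ ℓ₀ x≢y xℓ yℓ xℓ₀ yℓ₀))

    count-meets-at : ∀ {y} → T (I y ℓ₀) → ∀ ℓ → count (λ x → meets x y ℓ) ≡ 𝟙 ((I y ∖ ℓ₀) ℓ) * s
    count-meets-at {y} yℓ₀ ℓ with T? ((I y ∖ ℓ₀) ℓ)
    ... | no ¬new = trans
      (count-none (λ x → meets x y ℓ) λ x h → let _ , yℓ , x∉ℓ₀ , xℓ = meets⁻ h in
                              ¬new (T-∖⁺ (I y) (λ { refl → x∉ℓ₀ xℓ }) yℓ))
      (sym (cong (_* s) (𝟙-false ¬new)))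
    ... | yes new with ℓ≢ℓ₀ , yℓ ← T-∖⁻ (I y) new = begin
      count (λ x → meets x y ℓ)
        ≡⟨ count-cong (λ x → cong₂ (λ a b → a ∧ b ∧ off x ∧ I x ℓ) (T⇒≡true yℓ₀) (T⇒≡true yℓ)) ⟩
      count (λ x → off x ∧ I x ℓ)  ≡⟨ points-off yℓ₀ yℓ ℓ≢ℓ₀ ⟩
      s                            ≡⟨ *-identityˡ s ⟨
      1 * s                        ≡⟨ cong (_* s) (𝟙-true new) ⟨
      𝟙 ((I y ∖ ℓ₀) ℓ) * s         ∎
      where open ≡-Reasoning

    ∑-meets-at : ∀ y → ∑[ ℓ < n ] count (λ x → meets x y ℓ) ≡ 𝟙 (I y ℓ₀) * (t * s)
    ∑-meets-at y with T? (I y ℓ₀)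
    ... | no y∉ℓ₀ = trans
      (∑-count-none (λ ℓ x → meets x y ℓ) λ ℓ x h → y∉ℓ₀ (proj₁ (meets⁻ h)))
      (sym (cong (_* (t * s)) (𝟙-false y∉ℓ₀)))
    ... | yes yℓ₀ = begin
      ∑[ ℓ < n ] count (λ x → meets x y ℓ)  ≡⟨ sum-cong-≗ (count-meets-at yℓ₀) ⟩
      ∑[ ℓ < n ] (𝟙 ((I y ∖ ℓ₀) ℓ) * s)     ≡⟨ *-distribʳ-sum s (λ ℓ → 𝟙 ((I y ∖ ℓ₀) ℓ)) ⟨
      (∑[ ℓ < n ] 𝟙 ((I y ∖ ℓ₀) ℓ)) * s     ≡⟨ cong (_* s) (count≡∑ (I y ∖ ℓ₀)) ⟨
      count (I y ∖ ℓ₀) * s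
        ≡⟨ cong (_* s) (count-∖-pred (I y) (lines-through y) yℓ₀) ⟩
      t * s                                 ≡⟨ *-identityˡ (t * s) ⟨
      1 * (t * s)                           ≡⟨ cong (_* (t * s)) (𝟙-true yℓ₀) ⟨
      𝟙 (I y ℓ₀) * (t * s)                  ∎
      where open ≡-Reasoning

    count-off : count off ≡ suc s * (t * s)
    count-off = begin
      count off                                            ≡⟨ count≡∑ off ⟩
      ∑[ x < m ] 𝟙 (off x)                                 ≡⟨ sum-cong-≗ projection-unique ⟨
      ∑[ x < m ] ∑[ y < m ] count (meets x y)
        ≡⟨ sum-cong-≗ (λ x → sum-cong-≗ λ y → count≡∑ (meets x y)) ⟩
      ∑[ x < m ] ∑[ y < m ] ∑[ ℓ < n ] 𝟙 (meets x y ℓ)     ≡⟨ ∑-rotate (λ x y ℓ → 𝟙 (meets x y ℓ)) ⟩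
      ∑[ y < m ] ∑[ ℓ < n ] ∑[ x < m ] 𝟙 (meets x y ℓ)
        ≡⟨ sum-cong-≗ (λ y → sum-cong-≗ λ ℓ → count≡∑ (λ x → meets x y ℓ)) ⟨
      ∑[ y < m ] ∑[ ℓ < n ] count (λ x → meets x y ℓ)      ≡⟨ sum-cong-≗ ∑-meets-at ⟩
      ∑[ y < m ] (𝟙 (I y ℓ₀) * (t * s))
        ≡⟨ *-distribʳ-sum (t * s) (λ y → 𝟙 (I y ℓ₀)) ⟨
      (∑[ y < m ] 𝟙 (I y ℓ₀)) * (t * s)
        ≡⟨ cong (_* (t * s)) (trans (sym (count≡∑ (λ y → I y ℓ₀))) (points-on ℓ₀)) ⟩
      suc s * (t * s)                                      ∎
      where open ≡-Reasoning

  point-count : m ≡ (s + 1) * (s * t + 1)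
  point-count with ℓ₀ , _ ← count-witness (I nonempty) (lines-through nonempty) = begin
    m                                   ≡⟨ count-complement (λ x → I x ℓ₀) ⟨
    count (λ x → I x ℓ₀) + count off    ≡⟨ cong₂ _+_ (points-on ℓ₀) count-off ⟩
    suc s + suc s * (t * s)             ≡⟨ expand s t ⟩
    (s + 1) * (s * t + 1)               ∎
    where
    open ≡-Reasoning
    open PointsOffLine ℓ₀
    expand : ∀ s t → suc s + suc s * (t * s) ≡ (s + 1) * (s * t + 1)
    expand = solve-∀

  module CodeCount (C : Flag I → Bool) (perfect : IsPerfectCode I C) where
    open Flags I

    covers : Fin m → Fin n → Fin m → Fin n → Bool
    covers p ℓ p′ ℓ′ = I p ℓ ∧ codeword C p′ ℓ′ ∧ shares? p ℓ p′ ℓ′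

    covered-once : ∀ p ℓ → ∑[ p′ < m ] count (covers p ℓ p′) ≡ 𝟙 (I p ℓ)
    covered-once p ℓ with T? (I p ℓ)
    ... | no ¬pℓ = trans (∑-count-none (covers p ℓ) λ p′ ℓ′ h → ¬pℓ (proj₁ (T-∧⁻ h)))
                         (sym (𝟙-false ¬pℓ))
    ... | yes pℓ with (p₀ , ℓ₀ , pℓ₀) , (Cc , c∼v) , unique ← perfect (p , ℓ , pℓ) =
      trans (∑-count-unique (covers p ℓ) p₀ ℓ₀ covers₀ only) (sym (𝟙-true pℓ))
      where
      covers₀ : T (covers p ℓ p₀ ℓ₀)
      covers₀ = T-∧⁺ pℓ (T-∧⁺ (codeword⁺ C pℓ₀ Cc)
                  (T-shares?⁺ (Sum.map sym sym (InClosedNbhd⇒Shares c∼v))))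
      only : ∀ p′ ℓ′ → T (covers p ℓ p′ ℓ′) → p′ ≡ p₀ × ℓ′ ≡ ℓ₀
      only p′ ℓ′ h
        with _ , h′ ← T-∧⁻ {I p ℓ} h
        with cw , sh ← T-∧⁻ {codeword C p′ ℓ′} h′
        with p′ℓ′ , Cc′ ← codeword⁻ C cw
        with refl ← unique (p′ , ℓ′ , p′ℓ′) Cc′
               (Shares⇒InClosedNbhd _ _ (Sum.map sym sym (T-shares?⁻ sh))) = refl , refl

    nbhd-size : ∀ {p′ ℓ′} → T (I p′ ℓ′) →
      ∑[ p < m ] count (λ ℓ → I p ℓ ∧ shares? p ℓ p′ ℓ′) ≡ suc t + s
    nbhd-size {p′} {ℓ′} p′ℓ′ = begin
      ∑[ p < m ] count (λ ℓ → I p ℓ ∧ shares? p ℓ p′ ℓ′)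
        ≡⟨ sum-cong-≗ (λ p → trans (count≡∑ λ ℓ → I p ℓ ∧ shares? p ℓ p′ ℓ′)
                                   (sum-cong-≗ λ ℓ → 𝟙-∧-∨ (I p ℓ) ⌊ p ≟ p′ ⌋ ⌊ ℓ ≟ ℓ′ ⌋)) ⟩
      ∑[ p < m ] ∑[ ℓ < n ] (𝟙 (through p ℓ) + 𝟙 (on p ℓ))
        ≡⟨ sum-cong-≗ (λ p → ∑-distrib-+ (𝟙 ∘ through p) (𝟙 ∘ on p)) ⟩
      ∑[ p < m ] (∑[ ℓ < n ] 𝟙 (through p ℓ) + ∑[ ℓ < n ] 𝟙 (on p ℓ))
        ≡⟨ ∑-distrib-+ (λ p → ∑[ ℓ < n ] 𝟙 (through p ℓ)) (λ p → ∑[ ℓ < n ] 𝟙 (on p ℓ)) ⟩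
      ∑[ p < m ] ∑[ ℓ < n ] 𝟙 (through p ℓ) + ∑[ p < m ] ∑[ ℓ < n ] 𝟙 (on p ℓ)
        ≡⟨ cong₂ _+_ (∑-comm λ p ℓ → 𝟙 (through p ℓ)) (sum-cong-≗ λ p → sym (count≡∑ (on p))) ⟩
      ∑[ ℓ < n ] ∑[ p < m ] 𝟙 (through p ℓ) + ∑[ p < m ] count (on p)
        ≡⟨ cong₂ _+_ (sum-cong-≗ λ ℓ → trans (sym (count≡∑ λ p → through p ℓ))
                                               (count-at (λ p → I p ℓ) p′))
                     (sum-cong-≗ λ p → count-at (λ ℓ → ((λ q → I q ℓ) ∖ p′) p) ℓ′) ⟩
      ∑[ ℓ < n ] 𝟙 (I p′ ℓ) + ∑[ p < m ] 𝟙 (((λ q → I q ℓ′) ∖ p′) p)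
        ≡⟨ cong₂ _+_ (count≡∑ (I p′)) (count≡∑ ((λ q → I q ℓ′) ∖ p′)) ⟨
      count (I p′) + count ((λ q → I q ℓ′) ∖ p′)
        ≡⟨ cong₂ _+_ (lines-through p′) (count-∖-pred (λ q → I q ℓ′) (points-on ℓ′) p′ℓ′) ⟩
      suc t + s ∎
      where
      open ≡-Reasoning
      through on : Fin m → Fin n → Bool
      through p ℓ = ⌊ p ≟ p′ ⌋ ∧ I p ℓ
      on p ℓ = ⌊ ℓ ≟ ℓ′ ⌋ ∧ ((λ q → I q ℓ) ∖ p′) p

    covering-count : ∀ p′ ℓ′ →
      ∑[ p < m ] count (λ ℓ → covers p ℓ p′ ℓ′) ≡ 𝟙 (codeword C p′ ℓ′) * (suc t + s)
    covering-count p′ ℓ′ with T? (codeword C p′ ℓ′)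
    ... | no ¬cw = trans
      (∑-count-none (λ p ℓ → covers p ℓ p′ ℓ′) λ p ℓ h →
        ¬cw (proj₁ (T-∧⁻ (proj₂ (T-∧⁻ {I p ℓ} h)))))
      (sym (cong (_* (suc t + s)) (𝟙-false ¬cw)))
    ... | yes cw = begin
      ∑[ p < m ] count (λ ℓ → covers p ℓ p′ ℓ′)
        ≡⟨ sum-cong-≗ (λ p → count-cong λ ℓ →
             cong (λ b → I p ℓ ∧ b ∧ shares? p ℓ p′ ℓ′) (T⇒≡true cw)) ⟩
      ∑[ p < m ] count (λ ℓ → I p ℓ ∧ shares? p ℓ p′ ℓ′)   ≡⟨ nbhd-size (proj₁ (codeword⁻ C cw)) ⟩
      suc t + s                                            ≡⟨ *-identityˡ (suc t + s) ⟨
      1 * (suc t + s)                                      ≡⟨ cong (_* (suc t + s)) (𝟙-true cw) ⟨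
      𝟙 (codeword C p′ ℓ′) * (suc t + s)                   ∎
      where open ≡-Reasoning

    flag-count : m * suc t ≡ (∑[ p′ < m ] count (codeword C p′)) * (suc t + s)
    flag-count = begin
      m * suc t                                               ≡⟨ ∑-const m (suc t) ⟨
      ∑[ p < m ] suc t                                        ≡⟨ sum-cong-≗ lines-through ⟨
      ∑[ p < m ] count (I p)                                  ≡⟨ sum-cong-≗ (count≡∑ ∘ I) ⟩
      ∑[ p < m ] ∑[ ℓ < n ] 𝟙 (I p ℓ)
        ≡⟨ sum-cong-≗ (sum-cong-≗ ∘ covered-once) ⟨
      ∑[ p < m ] ∑[ ℓ < n ] ∑[ p′ < m ] count (covers p ℓ p′)
        ≡⟨ sum-cong-≗ (λ p → sum-cong-≗ λ ℓ → sum-cong-≗ λ p′ → count≡∑ (covers p ℓ p′)) ⟩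
      ∑[ p < m ] ∑[ ℓ < n ] ∑[ p′ < m ] ∑[ ℓ′ < n ] 𝟙 (covers p ℓ p′ ℓ′)
        ≡⟨ ∑∑-swap (λ p ℓ p′ ℓ′ → 𝟙 (covers p ℓ p′ ℓ′)) ⟩
      ∑[ p′ < m ] ∑[ ℓ′ < n ] ∑[ p < m ] ∑[ ℓ < n ] 𝟙 (covers p ℓ p′ ℓ′)
        ≡⟨ sum-cong-≗ (λ p′ → sum-cong-≗ λ ℓ′ → sum-cong-≗ λ p → count≡∑ λ ℓ → covers p ℓ p′ ℓ′) ⟨
      ∑[ p′ < m ] ∑[ ℓ′ < n ] ∑[ p < m ] count (λ ℓ → covers p ℓ p′ ℓ′)
        ≡⟨ sum-cong-≗ (sum-cong-≗ ∘ covering-count) ⟩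
      ∑[ p′ < m ] ∑[ ℓ′ < n ] (𝟙 (codeword C p′ ℓ′) * (suc t + s))
        ≡⟨ sum-cong-≗ (λ p′ → *-distribʳ-sum (suc t + s) (𝟙 ∘ codeword C p′)) ⟨
      ∑[ p′ < m ] (∑[ ℓ′ < n ] 𝟙 (codeword C p′ ℓ′) * (suc t + s))
        ≡⟨ *-distribʳ-sum (suc t + s) (λ p′ → ∑[ ℓ′ < n ] 𝟙 (codeword C p′ ℓ′)) ⟨
      (∑[ p′ < m ] ∑[ ℓ′ < n ] 𝟙 (codeword C p′ ℓ′)) * (suc t + s)
        ≡⟨ cong (λ x → x * (suc t + s)) (sum-cong-≗ (count≡∑ ∘ codeword C)) ⟨
      (∑[ p′ < m ] count (codeword C p′)) * (suc t + s)       ∎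
      where open ≡-Reasoning

  perfect-code⇒∣ : HasPerfectCode I → suc t + s ∣ m * suc t
  perfect-code⇒∣ (C , perfect) =
    divides (∑[ p < m ] count (Flags.codeword I C p)) (CodeCount.flag-count C perfect)


module ThickQuadrangle {s t m n : ℕ} {I : Incidence m n} (gq : IsGQ (suc s) (suc t) I) where
  open IsGQ gq
  open GeneralizedQuadrangle gq

  non-collinear-pair : ∃[ a ] ∃[ b ] ¬ a ~ b
  non-collinear-pair
    with ℓ , aℓ ← count-witness (I nonempty) (lines-through nonempty)
    with y , yℓ , y≢a ← another (λ p → I p ℓ) (points-on ℓ) aℓ
    with ℓ′ , yℓ′ , ℓ′≢ℓ ← another (I y) (lines-through y) yℓ
    with z , zℓ′ , z≢y ← another (λ p → I p ℓ′) (points-on ℓ′) yℓ′ =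
    nonempty , z , no-triangle a∉ℓ′ yℓ′ zℓ′ (≢-sym z≢y) (ℓ , aℓ , yℓ)
    where
    a∉ℓ′ : ¬ T (I nonempty ℓ′)
    a∉ℓ′ aℓ′ = ℓ′≢ℓ (atMostOneLine nonempty y ℓ′ ℓ (≢-sym y≢a) aℓ′ yℓ′ aℓ yℓ)

module QuadrangleOfOrder2 {m n : ℕ} {I : Incidence m n} (gq : IsGQ 2 2 I) where
  open IsGQ gq
  open GeneralizedQuadrangle gq
  open ThickQuadrangle gq using (non-collinear-pair)

  regularity : ∀ {X a b d} → Triad X → (∀ i → a ~ X i) → (∀ i → b ~ X i) →
    ¬ a ~ b → ¬ a ~ d → ¬ b ~ d → d ~ X 0F → d ~ X 1F → d ~ X 2F
  regularity {X} {a} {b} {d} triad a~X b~X a≁b a≁d b≁d (L , dL , X₀L) (M , dM , X₁M)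
    with d ~? X 2F
  ... | yes d~X₂ = d~X₂
  -- Otherwise X₂ is joined to L and to M by one and the same line (neither line through X₂ towards
  -- a or b will do), which then carries two points collinear with d.
  ... | no d≁X₂
    with e , eL , Ne , X₂Ne , eNe ← project (X 2F) L (λ X₂L → triad 0F 2F (λ ()) (L , X₀L , X₂L))
    with f , fM , Nf , X₂Nf , fNf ← project (X 2F) M (λ X₂M → triad 1F 2F (λ ()) (M , X₁M , X₂M))
    with A₂ , aA₂ , X₂A₂ ← a~X 2F
    with B₂ , bB₂ , X₂B₂ ← b~X 2F =
    ⊥-elim (no-triangle (λ dNe → d≁X₂ (Ne , dNe , X₂Ne)) eNe fNf′ e≢f (L , dL , eL) (M , dM , fM))
    where
    X₀≢e : X 0F ≢ e
    X₀≢e refl = triad 0F 2F (λ ()) (~-sym (Ne , X₂Ne , eNe))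
    X₁≢f : X 1F ≢ f
    X₁≢f refl = triad 1F 2F (λ ()) (~-sym (Nf , X₂Nf , fNf))
    e≢d : e ≢ d
    e≢d refl = d≁X₂ (~-sym (Ne , X₂Ne , eNe))
    off-Ne : ∀ {c} → c ~ X 0F → ¬ c ~ d → ¬ T (I c Ne)
    off-Ne c~X₀ c≁d cNe = no-triangle (λ cL → c≁d (L , cL , dL)) X₀L eL X₀≢e c~X₀ (Ne , cNe , eNe)
    off-Nf : ∀ {c} → c ~ X 1F → ¬ c ~ d → ¬ T (I c Nf)
    off-Nf c~X₁ c≁d cNf = no-triangle (λ cM → c≁d (M , cM , dM)) X₁M fM X₁≢f c~X₁ (Nf , cNf , fNf)
    Nf≡Ne : Nf ≡ Ne
    Nf≡Ne with exhaust₃ (I (X 2F)) (lines-through (X 2F)) X₂A₂ X₂B₂ X₂Ne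
                 (λ { refl → a≁b (A₂ , aA₂ , bB₂) })
                 (λ { refl → off-Ne (a~X 0F) a≁d aA₂ })
                 (λ { refl → off-Ne (b~X 0F) b≁d bB₂ }) Nf X₂Nf
    ... | inj₁ refl        = ⊥-elim (off-Nf (a~X 1F) a≁d aA₂)
    ... | inj₂ (inj₁ refl) = ⊥-elim (off-Nf (b~X 1F) b≁d bB₂)
    ... | inj₂ (inj₂ Nf≡Ne) = Nf≡Ne
    fNf′ : T (I f Ne)
    fNf′ = subst (T ∘ I f) Nf≡Ne fNf
    e≢f : e ≢ f
    e≢f refl = triad 0F 1F (λ ()) (L , X₀L , subst (T ∘ I (X 1F)) (sym L≡M) X₁M)
      where
      L≡M : L ≡ M
      L≡M = atMostOneLine e d L M e≢d eL dL fM dM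

  record OrthogonalTriads : Set where
    field
      U X     : Fin 3 → Fin m
      U-triad : Triad U
      X-triad : Triad X
      U~X     : ∀ i j → U i ~ X j

  trace-triad : ∀ {a b} {A : Fin 3 → Fin n} → ¬ a ~ b →
    (∀ i → T (I a (A i))) → (∀ i j → i ≢ j → A i ≢ A j) →
    ∃[ X ] Triad X × (∀ i → a ~ X i) × (∀ i → b ~ X i)
  trace-triad {a} {b} {A} a≁b aA A-distinct = X , X-triad , (λ i → A i , aA i , XA i) , b~X
    where
    b∉A : ∀ i → ¬ T (I b (A i))
    b∉A i bA = a≁b (A i , aA i , bA)
    X : Fin 3 → Fin m
    X i = proj₁ (project b (A i) (b∉A i))
    XA : ∀ i → T (I (X i) (A i))
    XA i = proj₁ (proj₂ (project b (A i) (b∉A i)))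
    b~X : ∀ i → b ~ X i
    b~X i = proj₂ (proj₂ (project b (A i) (b∉A i)))
    a≢X : ∀ i → a ≢ X i
    a≢X i a≡Xi = a≁b (~-sym (subst (b ~_) (sym a≡Xi) (b~X i)))
    X-triad : Triad X
    X-triad i j i≢j Xi~Xj =
      no-triangle Xj∉Ai (aA i) (XA i) (a≢X i) (A j , XA j , aA j) (~-sym Xi~Xj)
      where
      Xj∉Ai : ¬ T (I (X j) (A i))
      Xj∉Ai XjAi = A-distinct i j i≢j
        (atMostOneLine (X j) a (A i) (A j) (≢-sym (a≢X j)) XjAi (aA i) (XA j) (aA j))

  third-point : ∀ {X a b} → Triad X → (∀ i → a ~ X i) → (∀ i → b ~ X i) → ¬ a ~ b →
    ∃[ d ] ¬ a ~ d × ¬ b ~ d × d ~ X 0F × d ~ X 1F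
  third-point {X} {a} {b} triad a~X b~X a≁b
    with A₀ , aA₀ , X₀A₀ ← a~X 0F
    with B₀ , bB₀ , X₀B₀ ← b~X 0F
    with L , X₀L , L≢A₀ , L≢B₀ ← third (I (X 0F)) (lines-through (X 0F)) X₀A₀ X₀B₀
                                       (λ { refl → a≁b (A₀ , aA₀ , bB₀) })
    with d , dL , X₁~d ← project (X 1F) L (λ X₁L → triad 0F 1F (λ ()) (L , X₀L , X₁L)) =
    d , off a~X aA₀ X₀A₀ L≢A₀ , off b~X bB₀ X₀B₀ L≢B₀ , (L , dL , X₀L) , ~-sym X₁~d
    where
    off : ∀ {c C} → (∀ i → c ~ X i) → T (I c C) → T (I (X 0F) C) → L ≢ C → ¬ c ~ d
    off {c} {C} c~X cC X₀C L≢C =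
      no-triangle c∉L X₀L dL (λ { refl → triad 1F 0F (λ ()) X₁~d }) (c~X 0F)
      where
      c∉L : ¬ T (I c L)
      c∉L cL = L≢C (atMostOneLine c (X 0F) L C c≢X₀ cL X₀L cC X₀C)
        where
        c≢X₀ : c ≢ X 0F
        c≢X₀ refl = triad 0F 1F (λ ()) (c~X 1F)

  orthogonal-triads-of : ∀ {X a b d} → Triad X → (∀ i → a ~ X i) → (∀ i → b ~ X i) →
    ¬ a ~ b → ¬ a ~ d → ¬ b ~ d → d ~ X 0F → d ~ X 1F → OrthogonalTriads
  orthogonal-triads-of {X} {a} {b} {d} X-triad a~X b~X a≁b a≁d b≁d d~X₀ d~X₁ = record
    { U       = triple a b d
    ; X       = X
    ; U-triad = triple-pairwise (λ x y → ¬ x ~ y) (_∘ ~-sym) a≁b a≁d b≁d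
    ; X-triad = X-triad
    ; U~X     = U~X
    }
    where
    U~X : ∀ i j → triple a b d i ~ X j
    U~X 0F    = a~X
    U~X 1F    = b~X
    U~X 2F 0F = d~X₀
    U~X 2F 1F = d~X₁
    U~X 2F 2F = regularity X-triad a~X b~X a≁b a≁d b≁d d~X₀ d~X₁

  orthogonal-triads : OrthogonalTriads
  orthogonal-triads =
    let a , b , a≁b                 = non-collinear-pair
        A , aA , A-distinct         = three-distinct (I a) (lines-through a)
        X , X-triad , a~X , b~X     = trace-triad a≁b aA A-distinct
        d , a≁d , b≁d , d~X₀ , d~X₁ = third-point X-triad a~X b~X a≁b
    in orthogonal-triads-of X-triad a~X b~X a≁b a≁d b≁d d~X₀ d~X₁

  swap : OrthogonalTriads → OrthogonalTriads
  swap triads = record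
    { U = X ; X = U ; U-triad = X-triad ; X-triad = U-triad ; U~X = λ i j → ~-sym (U~X j i) }
    where open OrthogonalTriads triads

  module Triads (triads : OrthogonalTriads) where
    open OrthogonalTriads triads

    U≢X : ∀ i j → U i ≢ X j
    U≢X i j Ui≡Xj with k , k≢j ← another-index j =
      X-triad j k (≢-sym k≢j) (subst (_~ X k) Ui≡Xj (U~X i k))

    private
      M : Fin 3 → Fin 3 → Fin n
      M i j = proj₁ (U~X i j)
      UM : ∀ i j → T (I (U i) (M i j))
      UM i j = proj₁ (proj₂ (U~X i j))
      XM : ∀ i j → T (I (X j) (M i j))
      XM i j = proj₂ (proj₂ (U~X i j))
      M-distinct : ∀ i j k → j ≢ k → M i j ≢ M i k
      M-distinct i j k j≢k Mj≡Mk =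
        X-triad j k j≢k (M i j , XM i j , subst (T ∘ I (X k)) (sym Mj≡Mk) (XM i k))

    line-through-U-meets-X : ∀ i {ℓ} → T (I (U i) ℓ) → ∃[ j ] T (I (X j) ℓ)
    line-through-U-meets-X i {ℓ} Uiℓ
      with exhaust₃ (I (U i)) (lines-through (U i)) (UM i 0F) (UM i 1F) (UM i 2F)
             (M-distinct i 1F 0F (λ ())) (M-distinct i 2F 0F (λ ())) (M-distinct i 2F 1F (λ ()))
             ℓ Uiℓ
    ... | inj₁ refl        = 0F , XM i 0F
    ... | inj₂ (inj₁ refl) = 1F , XM i 1F
    ... | inj₂ (inj₂ refl) = 2F , XM i 2F

  module PerfectCode (triads : OrthogonalTriads) where
    open OrthogonalTriads triads
    open Triads triads
    open Triads (swap triads) using () renaming (line-through-U-meets-X to line-through-X-meets-U)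
    open Flags I

    Spanned : Fin m → Set
    Spanned p = (∃[ i ] p ≡ U i) ⊎ (∃[ j ] p ≡ X j)

    spanned? : ∀ p → Dec (Spanned p)
    spanned? p = any? (λ i → p ≟ U i) ⊎-dec any? (λ j → p ≟ X j)

    Joining : Fin n → Set
    Joining ℓ = ∃[ i ] T (I (U i) ℓ)

    joining? : ∀ ℓ → Dec (Joining ℓ)
    joining? ℓ = any? λ i → T? (I (U i) ℓ)

    code : Flag I → Bool
    code (p , ℓ , _) = ⌊ ¬? (spanned? p) ×-dec joining? ℓ ⌋

    spanned-joining : ∀ {p ℓ} → Spanned p → T (I p ℓ) → Joining ℓ
    spanned-joining (inj₁ (i , refl)) Uiℓ = i , Uiℓ
    spanned-joining (inj₂ (j , refl)) Xjℓ = line-through-X-meets-U j Xjℓ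

    joining-outsider : ∀ {ℓ} → Joining ℓ →
      ∃[ w ] T (I w ℓ) × ¬ Spanned w × (∀ y → T (I y ℓ) → ¬ Spanned y → y ≡ w)
    joining-outsider {ℓ} (i , Uiℓ)
      with j , Xjℓ ← line-through-U-meets-X i Uiℓ
      with w , wℓ , w≢Ui , w≢Xj ← third (λ p → I p ℓ) (points-on ℓ) Uiℓ Xjℓ (≢-sym (U≢X i j)) =
      w , wℓ , w∉ , only-w
      where
      w∉ : ¬ Spanned w
      w∉ (inj₁ (k , refl)) with refl ← triad-meets-line-once U-triad Uiℓ wℓ = w≢Ui refl
      w∉ (inj₂ (k , refl)) with refl ← triad-meets-line-once X-triad Xjℓ wℓ = w≢Xj refl
      only-w : ∀ y → T (I y ℓ) → ¬ Spanned y → y ≡ w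
      only-w y yℓ y∉ with exhaust₃ (λ p → I p ℓ) (points-on ℓ) Uiℓ Xjℓ wℓ
                            (≢-sym (U≢X i j)) w≢Ui w≢Xj y yℓ
      ... | inj₁ y≡Ui        = ⊥-elim (y∉ (inj₁ (i , y≡Ui)))
      ... | inj₂ (inj₁ y≡Xj) = ⊥-elim (y∉ (inj₂ (j , y≡Xj)))
      ... | inj₂ (inj₂ y≡w)  = y≡w

    joining-unique : ∀ {t M M′} → ¬ Spanned t →
      T (I t M) → Joining M → T (I t M′) → Joining M′ → M ≡ M′
    joining-unique {t} {M} {M′} t∉ tM (i , UiM) tM′ (k , UkM′) with i ≟ k
    ... | yes refl = atMostOneLine t (U i) M M′ (λ t≡Ui → t∉ (inj₁ (i , t≡Ui))) tM UiM tM′ UkM′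
    ... | no i≢k with j , XjM ← line-through-U-meets-X i UiM =
      ⊥-elim (no-triangle (λ UkM → i≢k (triad-meets-line-once U-triad UiM UkM)) tM XjM
                (λ t≡Xj → t∉ (inj₂ (j , t≡Xj))) (M′ , UkM′ , tM′) (U~X k j))

    -- t sees the third point w of the line U₀X₀; the third point of the line tw is then seen by
    -- both U₁ and U₂, which puts it on two joining lines.
    no-point-avoids-triads : ∀ t → (∀ i → ¬ t ~ U i) → (∀ j → ¬ t ~ X j) → ⊥
    no-point-avoids-triads t t≁U t≁X
      with ℓ₀ , U₀ℓ₀ , X₀ℓ₀ ← U~X 0F 0F
      with w , wℓ₀ , w≢U₀ , w≢X₀ ← third (λ p → I p ℓ₀) (points-on ℓ₀) U₀ℓ₀ X₀ℓ₀ (≢-sym (U≢X 0F 0F))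
      with y , yℓ₀ , t~y ← project t ℓ₀ (λ tℓ₀ → t≁U 0F (ℓ₀ , tℓ₀ , U₀ℓ₀))
      with exhaust₃ (λ p → I p ℓ₀) (points-on ℓ₀) U₀ℓ₀ X₀ℓ₀ wℓ₀ (≢-sym (U≢X 0F 0F)) w≢U₀ w≢X₀ y yℓ₀
    ... | inj₁ refl        = t≁U 0F t~y
    ... | inj₂ (inj₁ refl) = t≁X 0F t~y
    ... | inj₂ (inj₂ refl)
      with L , tL , wL ← t~y
      with w≢t ← (λ (w≡t : w ≡ t) → t≁U 0F (ℓ₀ , subst (λ x → T (I x ℓ₀)) w≡t wℓ₀ , U₀ℓ₀))
      with s , sL , s≢t , s≢w ← third (λ p → I p L) (points-on L) tL wL w≢t =
      U-triad 1F 2F (λ ()) (M₁ , U₁M₁ , subst (T ∘ I (U 2F)) (sym M₁≡M₂) U₂M₂)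
      where
      s∉ : ¬ Spanned s
      s∉ (inj₁ (i , refl)) = t≁U i (L , tL , sL)
      s∉ (inj₂ (j , refl)) = t≁X j (L , tL , sL)
      U-sees-s : ∀ k → k ≢ 0F → U k ~ s
      U-sees-s k k≢0 with y′ , y′L , Uk~y′ ← project (U k) L (λ UkL → t≁U k (L , tL , UkL))
        with exhaust₃ (λ p → I p L) (points-on L) tL wL sL w≢t s≢t s≢w y′ y′L
      ... | inj₁ refl        = ⊥-elim (t≁U k (~-sym Uk~y′))
      ... | inj₂ (inj₁ refl) = ⊥-elim (no-triangle (k≢0 ∘ flip (triad-meets-line-once U-triad) U₀ℓ₀)
                                         wℓ₀ X₀ℓ₀ w≢X₀ Uk~y′ (U~X k 0F))
      ... | inj₂ (inj₂ refl) = Uk~y′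
      M₁ M₂ : Fin n
      M₁ = proj₁ (U-sees-s 1F (λ ()))
      M₂ = proj₁ (U-sees-s 2F (λ ()))
      U₁M₁ = proj₁ (proj₂ (U-sees-s 1F (λ ())))
      U₂M₂ = proj₁ (proj₂ (U-sees-s 2F (λ ())))
      M₁≡M₂ : M₁ ≡ M₂
      M₁≡M₂ = joining-unique s∉ (proj₂ (proj₂ (U-sees-s 1F (λ ())))) (1F , U₁M₁)
                                (proj₂ (proj₂ (U-sees-s 2F (λ ())))) (2F , U₂M₂)

    joining-through : ∀ t → ∃[ M ] T (I t M) × Joining M
    joining-through t with any? (λ i → t ~? U i) | any? (λ j → t ~? X j)
    ... | yes (i , M , tM , UiM) | _                      = M , tM , i , UiM
    ... | no _                   | yes (j , M , tM , XjM) = M , tM , line-through-X-meets-U j XjM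
    ... | no t≁U                 | no t≁X                 =
      ⊥-elim (no-point-avoids-triads t (λ i t~Ui → t≁U (i , t~Ui)) (λ j t~Xj → t≁X (j , t~Xj)))

    code⁺ : ∀ {p ℓ} (pℓ : T (I p ℓ)) → ¬ Spanned p → Joining ℓ → T (code (p , ℓ , pℓ))
    code⁺ _ p∉ Jℓ = fromWitness (p∉ , Jℓ)

    code⁻ : ∀ {p ℓ} (pℓ : T (I p ℓ)) → T (code (p , ℓ , pℓ)) → ¬ Spanned p × Joining ℓ
    code⁻ _ = toWitness

    CoveredOnce : Flag I → Set
    CoveredOnce v = Σ[ c ∈ Flag I ] ((T (code c) × InClosedNbhd I c v) ×
                      ((c′ : Flag I) → T (code c′) → InClosedNbhd I c′ v → c′ ≡ c))

    covered-by : ∀ v c → T (code c) → Shares c v →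
      (∀ c′ → T (code c′) → Shares c′ v → c′ ≡ c) → CoveredOnce v
    covered-by v c code-c c-v unique =
      c , (code-c , Shares⇒InClosedNbhd c v c-v) ,
      λ c′ code-c′ → unique c′ code-c′ ∘ InClosedNbhd⇒Shares

    spanned-covered : ∀ {p ℓ} (pℓ : T (I p ℓ)) → Spanned p → CoveredOnce (p , ℓ , pℓ)
    spanned-covered {p} {ℓ} pℓ p∈ =
      let Jℓ = spanned-joining p∈ pℓ ; w , wℓ , w∉ , only-w = joining-outsider Jℓ
          unique : ∀ c′ → T (code c′) → Shares c′ (p , ℓ , pℓ) → c′ ≡ (w , ℓ , wℓ)
          unique = λ where
            (p′ , ℓ′ , p′ℓ′) c′ (inj₁ refl) → ⊥-elim (proj₁ (code⁻ p′ℓ′ c′) p∈)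
            (p′ , ℓ′ , p′ℓ′) c′ (inj₂ refl) → flag-≡ (only-w p′ p′ℓ′ (proj₁ (code⁻ p′ℓ′ c′))) refl
      in covered-by _ (w , ℓ , wℓ) (code⁺ wℓ w∉ Jℓ) (inj₂ refl) unique

    codeword-covered : ∀ {p ℓ} (pℓ : T (I p ℓ)) → ¬ Spanned p → Joining ℓ → CoveredOnce (p , ℓ , pℓ)
    codeword-covered {p} {ℓ} pℓ p∉ Jℓ = covered-by _ _ (code⁺ pℓ p∉ Jℓ) (inj₁ refl) unique
      where
      unique : ∀ c′ → T (code c′) → Shares c′ (p , ℓ , pℓ) → c′ ≡ (p , ℓ , pℓ)
      unique (p′ , ℓ′ , p′ℓ′) c′ (inj₁ refl) =
        flag-≡ refl (joining-unique p∉ p′ℓ′ (proj₂ (code⁻ p′ℓ′ c′)) pℓ Jℓ)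
      unique (p′ , ℓ′ , p′ℓ′) c′ (inj₂ refl) =
        let _ , _ , _ , only-w = joining-outsider Jℓ in
        flag-≡ (trans (only-w p′ p′ℓ′ (proj₁ (code⁻ p′ℓ′ c′))) (sym (only-w p pℓ p∉))) refl

    outsider-covered : ∀ {p ℓ} (pℓ : T (I p ℓ)) → ¬ Spanned p → ¬ Joining ℓ →
      CoveredOnce (p , ℓ , pℓ)
    outsider-covered {p} {ℓ} pℓ p∉ ¬Jℓ =
      let M , pM , JM = joining-through p
          unique : ∀ c′ → T (code c′) → Shares c′ (p , ℓ , pℓ) → c′ ≡ (p , M , pM)
          unique = λ where
            (p′ , ℓ′ , p′ℓ′) c′ (inj₁ refl) →
              flag-≡ refl (joining-unique p∉ p′ℓ′ (proj₂ (code⁻ p′ℓ′ c′)) pM JM)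
            (p′ , ℓ′ , p′ℓ′) c′ (inj₂ refl) → ⊥-elim (¬Jℓ (proj₂ (code⁻ p′ℓ′ c′)))
      in covered-by _ (p , M , pM) (code⁺ pM p∉ JM) (inj₁ refl) unique

    perfect : IsPerfectCode I code
    perfect (p , ℓ , pℓ) = cases (spanned? p) (joining? ℓ)
      where
      cases : Dec (Spanned p) → Dec (Joining ℓ) → CoveredOnce (p , ℓ , pℓ)
      cases (yes p∈) _        = spanned-covered pℓ p∈
      cases (no p∉)  (yes Jℓ) = codeword-covered pℓ p∉ Jℓ
      cases (no p∉)  (no ¬Jℓ) = outsider-covered pℓ p∉ ¬Jℓ

  has-perfect-code : HasPerfectCode I
  has-perfect-code = PerfectCode.code orthogonal-triads , PerfectCode.perfect orthogonal-triads

proposition4p5 : (q : ℕ) → 1 ≤ q → (m n : ℕ) (I : Incidence m n) →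
    IsGQ q q I → (HasPerfectCode I ⇔ q ≡ 2)
proposition4p5 q 1≤q m n I gq = mk⇔ code⇒q≡2 q≡2⇒code
  where
  open GeneralizedQuadrangle gq using (point-count; perfect-code⇒∣)
  code⇒q≡2 : HasPerfectCode I → q ≡ 2
  code⇒q≡2 code = 2q+1∣[q+1]²[q²+1]⇒q≡2 q 1≤q
    (subst (λ k → suc q + q ∣ k * suc q) point-count (perfect-code⇒∣ code))
  q≡2⇒code : q ≡ 2 → HasPerfectCode I
  q≡2⇒code refl = QuadrangleOfOrder2.has-perfect-code gq
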